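{- Let $d\ge1$ be an integer. Consider $d$ agents which all start at the same time; in each step, each agent (still running) independently flips a fair coin, going to the next step on outcome $1$ and terminating at that step on outcome $0$. Let $y_d$ be the probability that the first agent executes strictly more steps than each of the other $d-1$ agents before terminating. Then $y_d\ge \frac{2}{3d}$. -}

module Defs where

open import Data.Bool using (Bool; true; false; _∧_)
open import Data.Nat using (ℕ; zero; suc; _<ᵇ_; _+_; _*_; _^_)
open import Data.Maybe using (Maybe; just; nothing)
open import Data.List using (List; []; _∷_; map; concatMap; length; filter)
open import Data.Vec using (Vec; []; _∷_)
open import Relation.Nullary.Decidable using (does)
open import Data.Bool.Properties using (_≟_)
open import Relation.Binary.PropositionalEquality using (_≡_)

-- Coin record of one agent for the first N steps: entry i is the outcome
-- of the coin flipped at step i (true = 1 = continue, false = 0 = terminate).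
steps : ∀ {N} → Vec Bool N → Maybe ℕ
steps [] = nothing
steps (false ∷ _) = just 0
steps (true ∷ bs) with steps bs
... | just t = just (suc t)
... | nothing = nothing

-- "agent j executed strictly fewer steps than t" (decided from the first N flips,
-- valid when t < N: an agent with no 0 among N flips runs ≥ N > t steps)
fewerThan : ∀ {N} → ℕ → Vec Bool N → Bool
fewerThan t bs with steps bs
... | just s = s <ᵇ t
... | nothing = false

allFewer : ∀ {N d} → ℕ → Vec (Vec Bool N) d → Bool
allFewer t [] = true
allFewer t (bs ∷ rest) = fewerThan t bs ∧ allFewer t rest

-- Event E_N (depends only on the first N flips of each agent):
-- the first agent terminates within the first N steps, and every other agent
-- executed strictly fewer steps than it.  E_N increases to the event
-- "agent 1 executes strictly more steps than each other agent", so
-- y_d = sup_N P(E_N).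
firstWins : ∀ {N d} → Vec (Vec Bool N) d → Bool
firstWins [] = false
firstWins (b₁ ∷ rest) with steps b₁
... | just t = allFewer t rest
... | nothing = false

allVecs : ∀ {A : Set} → List A → (n : ℕ) → List (Vec A n)
allVecs xs zero = [] ∷ []
allVecs xs (suc n) = concatMap (λ x → map (x ∷_) (allVecs xs n)) xs

bools : List Bool
bools = true ∷ false ∷ []

-- All 2^(d*N) equally likely outcomes (fair independent coins) of the
-- first N flips of each of the d agents.
outcomes : (d N : ℕ) → List (Vec (Vec Bool N) d)
outcomes d N = allVecs (allVecs bools N) d

-- Number of outcomes in E_N; P(E_N) = winCount d N / 2^(d*N).
winCount : (d N : ℕ) → ℕ
winCount d N = length (filter (λ o → firstWins o ≟ true) (outcomes d N))

{-# OPTIONS --safe #-}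
-- Write d = n + 1 and record N coin flips per agent. Of the 2^N records, 2^(N−1−t) stop
-- at step t and c t = 2^N − 2^(N−t) stop before it, so winCount d N = Σ_{t<N} 2^(N−1−t) · (c t)^n.
-- Scaled by 2^(−dN) this is the left Riemann sum of x^n on the grid x_t = 1 − 2^(−t), whose
-- spacing halves at every step. By the trapezoid rule for the convex x^n, each cell's
-- integral is at most the mean of the two endpoint terms; since the spacing halves, the
-- right endpoint term of a cell is twice the left endpoint term of the next one. Summing,
-- the integral 1/d is at most 3/2 of the Riemann sum plus a boundary term:
-- P(E_N) ≥ 2/(3d) − 2^(−N) ≥ 2/(3d) − 1/N.
module Submission where

open import Defs
open import Data.Nat using (ℕ; zero; suc; _≤_; _<_; _+_; _*_; _^_; _∸_; _<ᵇ_; z≤n; s≤s)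
open import Data.Nat.Properties hiding (_≟_)
open import Data.Nat.ListAction using (sum)
open import Data.Nat.ListAction.Properties using (sum-++)
open import Data.Nat.Tactic.RingSolver using (solve-∀)
open import Data.Bool using (Bool; true; false; _∧_)
open import Data.Bool.Properties using (_≟_)
open import Data.List using (List; []; _∷_; map; length; filter; concatMap; _++_)
open import Data.List.Properties using (map-++; map-cong; map-∘)
open import Data.Vec using (Vec; _∷_)
open import Data.Maybe as Maybe using (Maybe; just; nothing; maybe)
open import Data.Product using (∃-syntax; _,_)
open import Function using (_∘_)
open import Relation.Binary.PropositionalEquality
  using (_≡_; refl; sym; trans; cong; cong₂; subst; module ≡-Reasoning)

bernoulli : ∀ n c e → c ^ suc n + suc n * e * c ^ n ≤ (c + e) ^ suc n
bernoulli zero    c e = ≤-reflexive (base c e)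
  where
  base : ∀ c e → c * 1 + 1 * e * 1 ≡ (c + e) * 1
  base = solve-∀
bernoulli (suc n) c e = begin
    c ^ suc (suc n) + suc (suc n) * e * c ^ suc n
  ≤⟨ m≤m+n _ (suc n * e * e * c ^ n) ⟩
    c ^ suc (suc n) + suc (suc n) * e * c ^ suc n + suc n * e * e * c ^ n
  ≡⟨ expand n c e (c ^ n) ⟩
    (c + e) * (c ^ suc n + suc n * e * c ^ n)
  ≤⟨ *-monoʳ-≤ (c + e) (bernoulli n c e) ⟩
    (c + e) ^ suc (suc n)
  ∎
  where
  open ≤-Reasoning
  expand : ∀ n c e p → c * (c * p) + suc (suc n) * e * (c * p) + suc n * e * e * p
                       ≡ (c + e) * (c * p + suc n * e * p)
  expand = solve-∀

-- The trapezoid rule overestimates the integral (c + e) ^ d − c ^ d of the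
-- convex function d · x ^ (d − 1) over [c, c + e].
trapezoid : ∀ n c e → 2 * (c + e) ^ suc n ≤ 2 * c ^ suc n + suc n * e * (c ^ n + (c + e) ^ n)
trapezoid zero    c e = ≤-reflexive (base c e)
  where
  base : ∀ c e → 2 * ((c + e) * 1) ≡ 2 * (c * 1) + 1 * e * (1 + 1)
  base = solve-∀
trapezoid (suc n) c e = begin
    2 * (c + e) ^ suc (suc n)
  ≡⟨ pull (c + e) ((c + e) ^ suc n) ⟩
    (c + e) * (2 * (c + e) ^ suc n)
  ≤⟨ *-monoʳ-≤ (c + e) (trapezoid n c e) ⟩
    (c + e) * (2 * c ^ suc n + suc n * e * (c ^ n + (c + e) ^ n))
  ≡⟨ expand n c e (c ^ n) ((c + e) ^ n) ⟩
    2 * c ^ suc (suc n) + suc (suc n) * e * c ^ suc n + suc n * e * (c + e) ^ suc n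
      + e * (c ^ suc n + suc n * e * c ^ n)
  ≤⟨ +-monoʳ-≤ _ (*-monoʳ-≤ e (bernoulli n c e)) ⟩
    2 * c ^ suc (suc n) + suc (suc n) * e * c ^ suc n + suc n * e * (c + e) ^ suc n
      + e * (c + e) ^ suc n
  ≡⟨ collect n c e (c ^ suc n) ((c + e) ^ suc n) ⟩
    2 * c ^ suc (suc n) + suc (suc n) * e * (c ^ suc n + (c + e) ^ suc n)
  ∎
  where
  open ≤-Reasoning
  pull : ∀ a q → 2 * (a * q) ≡ a * (2 * q)
  pull = solve-∀
  expand : ∀ n c e p q → (c + e) * (2 * (c * p) + suc n * e * (p + q))
                         ≡ 2 * (c * (c * p)) + suc (suc n) * e * (c * p) + suc n * e * ((c + e) * q)
                           + e * (c * p + suc n * e * p)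
  expand = solve-∀
  collect : ∀ n c e p q → 2 * (c * p) + suc (suc n) * e * p + suc n * e * q + e * q
                          ≡ 2 * (c * p) + suc (suc n) * e * (p + q)
  collect = solve-∀

-- Σ_{t<N} 2^(N−1−t) · h t
dyadicSum : ℕ → (ℕ → ℕ) → ℕ
dyadicSum zero    h = 0
dyadicSum (suc N) h = dyadicSum N (λ t → h (suc t)) + 2 ^ N * h 0

dyadicSum-zero : ∀ N → dyadicSum N (λ _ → 0) ≡ 0
dyadicSum-zero zero    = refl
dyadicSum-zero (suc N) = cong₂ _+_ (dyadicSum-zero N) (*-zeroʳ (2 ^ N))

dyadicSum-snoc : ∀ N h → dyadicSum (suc N) h ≡ 2 * dyadicSum N h + h N
dyadicSum-snoc zero    h = +-identityʳ (h 0)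
dyadicSum-snoc (suc N) h = begin
    dyadicSum (suc N) (λ t → h (suc t)) + 2 ^ suc N * h 0
  ≡⟨ cong (_+ 2 ^ suc N * h 0) (dyadicSum-snoc N (λ t → h (suc t))) ⟩
    2 * dyadicSum N (λ t → h (suc t)) + h (suc N) + 2 ^ suc N * h 0
  ≡⟨ rearrange (dyadicSum N (λ t → h (suc t))) (h (suc N)) (2 ^ N) (h 0) ⟩
    2 * (dyadicSum N (λ t → h (suc t)) + 2 ^ N * h 0) + h (suc N)
  ∎
  where
  open ≡-Reasoning
  rearrange : ∀ s a p b → 2 * s + a + 2 * p * b ≡ 2 * (s + p * b) + a
  rearrange = solve-∀

record HalvingGrid (x e : ℕ → ℕ) (T : ℕ) : Set where
  field
    start : x 0 ≡ 0
    step  : ∀ {u} → u < T → x (suc u) ≡ x u + e (suc u)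
    halve : ∀ {u} → u < T → e u ≡ 2 * e (suc u)

restrict : ∀ {x e T} → HalvingGrid x e (suc T) → HalvingGrid x e T
restrict grid = record { start = start ; step = step ∘ m<n⇒m<1+n ; halve = halve ∘ m<n⇒m<1+n }
  where open HalvingGrid grid

-- e T · dyadicSum T (λ u → x u ^ n) = Σ_{u<T} e (suc u) · x u ^ n is the left Riemann
-- sum of x ↦ x ^ n over [0, x T], whose integral is x T ^ d / d.
riemann-invariant : ∀ n {x e} T → HalvingGrid x e T →
  2 * x T ^ suc n ≤ 3 * suc n * e T * dyadicSum T (λ u → x u ^ n) + suc n * e T * x T ^ n
riemann-invariant n zero grid rewrite HalvingGrid.start grid = z≤n
riemann-invariant n {x} {e} (suc T) grid = begin
    2 * x (suc T) ^ suc n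
  ≡⟨ cong (λ y → 2 * y ^ suc n) x-step ⟩
    2 * (c + ε) ^ suc n
  ≤⟨ trapezoid n c ε ⟩
    2 * c ^ suc n + d * ε * (c ^ n + (c + ε) ^ n)
  ≤⟨ +-monoˡ-≤ _ ih ⟩
    3 * d * (2 * ε) * G + d * (2 * ε) * c ^ n + d * ε * (c ^ n + (c + ε) ^ n)
  ≡⟨ regroup d ε G (c ^ n) ((c + ε) ^ n) ⟩
    3 * d * ε * (2 * G + c ^ n) + d * ε * (c + ε) ^ n
  ≡⟨ cong₂ (λ s y → 3 * d * ε * s + d * ε * y ^ n) (sym (dyadicSum-snoc T _)) (sym x-step) ⟩
    3 * d * ε * dyadicSum (suc T) (λ u → x u ^ n) + d * ε * x (suc T) ^ n
  ∎
  where
  open ≤-Reasoning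
  open HalvingGrid grid
  d c ε G : ℕ
  d = suc n
  c = x T
  ε = e (suc T)
  G = dyadicSum T (λ u → x u ^ n)
  x-step : x (suc T) ≡ c + ε
  x-step = step ≤-refl
  ih : 2 * c ^ suc n ≤ 3 * d * (2 * ε) * G + d * (2 * ε) * c ^ n
  ih = subst (λ w → 2 * c ^ suc n ≤ 3 * d * w * G + d * w * c ^ n) (halve ≤-refl)
             (riemann-invariant n T (restrict grid))
  regroup : ∀ d ε G p q → 3 * d * (2 * ε) * G + d * (2 * ε) * p + d * ε * (p + q)
                          ≡ 3 * d * ε * (2 * G + p) + d * ε * q
  regroup = solve-∀

riemann-bound : ∀ n {x e} T → HalvingGrid x e T →
  2 * (x T + e T) ^ suc n ≤ 3 * suc n * e T * (dyadicSum T (λ u → x u ^ n) + (x T + e T) ^ n)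
riemann-bound n {x} {e} T grid = begin
    2 * (c + ε) ^ suc n
  ≤⟨ trapezoid n c ε ⟩
    2 * c ^ suc n + d * ε * (c ^ n + q)
  ≤⟨ +-monoˡ-≤ _ (riemann-invariant n T grid) ⟩
    3 * d * ε * G + d * ε * c ^ n + d * ε * (c ^ n + q)
  ≤⟨ +-mono-≤ (+-monoʳ-≤ (3 * d * ε * G) (*-monoʳ-≤ (d * ε) p≤q))
              (*-monoʳ-≤ (d * ε) (+-monoˡ-≤ q p≤q)) ⟩
    3 * d * ε * G + d * ε * q + d * ε * (q + q)
  ≡⟨ regroup d ε G q ⟩
    3 * d * ε * (G + q)
  ∎
  where
  open ≤-Reasoning
  d c ε q G : ℕ
  d = suc n
  c = x T
  ε = e T
  q = (c + ε) ^ n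
  G = dyadicSum T (λ u → x u ^ n)
  p≤q : c ^ n ≤ q
  p≤q = ^-monoˡ-≤ n (m≤m+n c ε)
  regroup : ∀ d ε G q → 3 * d * ε * G + d * ε * q + d * ε * (q + q) ≡ 3 * d * ε * (G + q)
  regroup = solve-∀

toℕ : Bool → ℕ
toℕ true  = 1
toℕ false = 0

toℕ-∧ : ∀ a b → toℕ (a ∧ b) ≡ toℕ a * toℕ b
toℕ-∧ true  b = sym (*-identityˡ (toℕ b))
toℕ-∧ false b = refl

length-filter≡sum : ∀ {A : Set} (p : A → Bool) xs →
  length (filter (λ x → p x ≟ true) xs) ≡ sum (map (toℕ ∘ p) xs)
length-filter≡sum p []       = refl
length-filter≡sum p (x ∷ xs) with p x
... | true  = cong suc (length-filter≡sum p xs)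
... | false = length-filter≡sum p xs

sum-const : ∀ {A : Set} (xs : List A) k → sum (map (λ _ → k) xs) ≡ length xs * k
sum-const []       k = refl
sum-const (x ∷ xs) k = cong (k +_) (sum-const xs k)

sum-*ˡ : ∀ {A : Set} k (f : A → ℕ) xs → sum (map (λ x → k * f x) xs) ≡ k * sum (map f xs)
sum-*ˡ k f []       = sym (*-zeroʳ k)
sum-*ˡ k f (x ∷ xs) = trans (cong (k * f x +_) (sum-*ˡ k f xs)) (sym (*-distribˡ-+ k (f x) _))

sum-outer-product : ∀ {A B : Set} (f : A → ℕ) (g : B → ℕ) xs ys →
  sum (map (λ x → sum (map (λ y → f x * g y) ys)) xs) ≡ sum (map f xs) * sum (map g ys)
sum-outer-product f g []       ys = refl
sum-outer-product f g (x ∷ xs) ys = begin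
    sum (map (λ y → f x * g y) ys) + sum (map (λ x → sum (map (λ y → f x * g y) ys)) xs)
  ≡⟨ cong₂ _+_ (sum-*ˡ (f x) g ys) (sum-outer-product f g xs ys) ⟩
    f x * sum (map g ys) + sum (map f xs) * sum (map g ys)
  ≡⟨ sym (*-distribʳ-+ (sum (map g ys)) (f x) _) ⟩
    (f x + sum (map f xs)) * sum (map g ys)
  ∎
  where open ≡-Reasoning

sum-concatMap : ∀ {A B : Set} (f : B → ℕ) (g : A → List B) xs →
  sum (map f (concatMap g xs)) ≡ sum (map (λ x → sum (map f (g x))) xs)
sum-concatMap f g []       = refl
sum-concatMap f g (x ∷ xs) = begin
    sum (map f (g x ++ concatMap g xs))
  ≡⟨ cong sum (map-++ f (g x) _) ⟩
    sum (map f (g x) ++ map f (concatMap g xs))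
  ≡⟨ sum-++ (map f (g x)) _ ⟩
    sum (map f (g x)) + sum (map f (concatMap g xs))
  ≡⟨ cong (sum (map f (g x)) +_) (sum-concatMap f g xs) ⟩
    sum (map f (g x)) + sum (map (λ x → sum (map f (g x))) xs)
  ∎
  where open ≡-Reasoning

sum-allVecs : ∀ {A : Set} (xs : List A) n (f : Vec A (suc n) → ℕ) →
  sum (map f (allVecs xs (suc n))) ≡ sum (map (λ x → sum (map (λ v → f (x ∷ v)) (allVecs xs n))) xs)
sum-allVecs xs n f = trans (sum-concatMap f _ xs)
  (cong sum (map-cong (λ x → cong sum (sym (map-∘ (allVecs xs n)))) xs))

sum-const-allVecs : ∀ {A : Set} (xs : List A) n k →
  sum (map (λ _ → k) (allVecs xs n)) ≡ length xs ^ n * k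
sum-const-allVecs xs zero    k = refl
sum-const-allVecs xs (suc n) k = begin
    sum (map (λ _ → k) (allVecs xs (suc n)))
  ≡⟨ sum-allVecs xs n (λ _ → k) ⟩
    sum (map (λ _ → sum (map (λ _ → k) (allVecs xs n))) xs)
  ≡⟨ sum-const xs _ ⟩
    length xs * sum (map (λ _ → k) (allVecs xs n))
  ≡⟨ cong (length xs *_) (sum-const-allVecs xs n k) ⟩
    length xs * (length xs ^ n * k)
  ≡⟨ sym (*-assoc (length xs) _ k) ⟩
    length xs ^ suc n * k
  ∎
  where open ≡-Reasoning

steps-true : ∀ {N} (b : Vec Bool N) → steps (true ∷ b) ≡ Maybe.map suc (steps b)
steps-true b with steps b
... | just t  = refl
... | nothing = refl

sum-steps : ∀ N (h : Maybe ℕ → ℕ) →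
  sum (map (h ∘ steps) (allVecs bools N)) ≡ dyadicSum N (h ∘ just) + h nothing
sum-steps zero    h = +-identityʳ (h nothing)
sum-steps (suc N) h = begin
    sum (map (h ∘ steps) (allVecs bools (suc N)))
  ≡⟨ sum-allVecs bools N (h ∘ steps) ⟩
    sum (map (λ b → h (steps (true ∷ b))) records) + (sum (map (λ _ → h (just 0)) records) + 0)
  ≡⟨ cong₂ (λ a b → a + (b + 0)) continuing (sum-const-allVecs bools N (h (just 0))) ⟩
    dyadicSum N (λ t → h (just (suc t))) + h nothing + (2 ^ N * h (just 0) + 0)
  ≡⟨ rearrange _ (h nothing) (2 ^ N * h (just 0)) ⟩
    dyadicSum N (λ t → h (just (suc t))) + 2 ^ N * h (just 0) + h nothing
  ∎
  where
  open ≡-Reasoning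
  records : List (Vec Bool N)
  records = allVecs bools N
  continuing : sum (map (λ b → h (steps (true ∷ b))) records)
               ≡ dyadicSum N (λ t → h (just (suc t))) + h nothing
  continuing = trans (cong sum (map-cong (cong h ∘ steps-true) records))
                     (sum-steps N (h ∘ Maybe.map suc))
  rearrange : ∀ s a b → s + a + (b + 0) ≡ s + b + a
  rearrange = solve-∀

fewerCount : ℕ → ℕ → ℕ
fewerCount N t = dyadicSum N (λ s → toℕ (s <ᵇ t))

sum-fewerThan : ∀ N t → sum (map (toℕ ∘ fewerThan t) (allVecs bools N)) ≡ fewerCount N t
sum-fewerThan N t = begin
    sum (map (toℕ ∘ fewerThan t) (allVecs bools N))
  ≡⟨ cong sum (map-cong toℕ-fewerThan (allVecs bools N)) ⟩
    sum (map (maybe (λ s → toℕ (s <ᵇ t)) 0 ∘ steps) (allVecs bools N))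
  ≡⟨ sum-steps N (maybe (λ s → toℕ (s <ᵇ t)) 0) ⟩
    fewerCount N t + 0
  ≡⟨ +-identityʳ _ ⟩
    fewerCount N t
  ∎
  where
  open ≡-Reasoning
  toℕ-fewerThan : (b : Vec Bool N) → toℕ (fewerThan t b) ≡ maybe (λ s → toℕ (s <ᵇ t)) 0 (steps b)
  toℕ-fewerThan b with steps b
  ... | just s  = refl
  ... | nothing = refl

sum-allFewer : ∀ n N t → sum (map (toℕ ∘ allFewer t) (outcomes n N)) ≡ fewerCount N t ^ n
sum-allFewer zero    N t = refl
sum-allFewer (suc n) N t = begin
    sum (map (toℕ ∘ allFewer t) (outcomes (suc n) N))
  ≡⟨ sum-allVecs (allVecs bools N) n _ ⟩
    sum (map (λ b → sum (map (λ r → toℕ (fewerThan t b ∧ allFewer t r)) (outcomes n N))) (allVecs bools N))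
  ≡⟨ cong sum (map-cong (λ b → cong sum (map-cong (toℕ-∧ (fewerThan t b) ∘ allFewer t) (outcomes n N)))
                        (allVecs bools N)) ⟩
    sum (map (λ b → sum (map (λ r → toℕ (fewerThan t b) * toℕ (allFewer t r)) (outcomes n N))) (allVecs bools N))
  ≡⟨ sum-outer-product (toℕ ∘ fewerThan t) (toℕ ∘ allFewer t) (allVecs bools N) (outcomes n N) ⟩
    sum (map (toℕ ∘ fewerThan t) (allVecs bools N)) * sum (map (toℕ ∘ allFewer t) (outcomes n N))
  ≡⟨ cong₂ _*_ (sum-fewerThan N t) (sum-allFewer n N t) ⟩
    fewerCount N t ^ suc n
  ∎
  where open ≡-Reasoning

sum-firstWins : ∀ n {N} (b : Vec Bool N) →
  sum (map (λ r → toℕ (firstWins (b ∷ r))) (outcomes n N)) ≡ maybe (λ t → fewerCount N t ^ n) 0 (steps b)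
sum-firstWins n {N} b with steps b
... | just t  = sum-allFewer n N t
... | nothing = trans (sum-const-allVecs (allVecs bools N) n 0) (*-zeroʳ (length (allVecs bools N) ^ n))

winCount-suc : ∀ n N → winCount (suc n) N ≡ dyadicSum N (λ t → fewerCount N t ^ n)
winCount-suc n N = begin
    winCount (suc n) N
  ≡⟨ length-filter≡sum firstWins (outcomes (suc n) N) ⟩
    sum (map (toℕ ∘ firstWins) (outcomes (suc n) N))
  ≡⟨ sum-allVecs (allVecs bools N) n _ ⟩
    sum (map (λ b → sum (map (λ r → toℕ (firstWins (b ∷ r))) (outcomes n N))) (allVecs bools N))
  ≡⟨ cong sum (map-cong (sum-firstWins n) (allVecs bools N)) ⟩
    sum (map (maybe (λ t → fewerCount N t ^ n) 0 ∘ steps) (allVecs bools N))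
  ≡⟨ sum-steps N (maybe (λ t → fewerCount N t ^ n) 0) ⟩
    dyadicSum N (λ t → fewerCount N t ^ n) + 0
  ≡⟨ +-identityʳ _ ⟩
    dyadicSum N (λ t → fewerCount N t ^ n)
  ∎
  where open ≡-Reasoning

fewerCount-complement : ∀ {N t} → t ≤ N → fewerCount N t + 2 ^ (N ∸ t) ≡ 2 ^ N
fewerCount-complement {N} z≤n = cong (_+ 2 ^ N) (dyadicSum-zero N)
fewerCount-complement (s≤s {t} {N} t≤N) = begin
    fewerCount N t + 2 ^ N * 1 + 2 ^ (N ∸ t)
  ≡⟨ swap (fewerCount N t) (2 ^ N) (2 ^ (N ∸ t)) ⟩
    fewerCount N t + 2 ^ (N ∸ t) + 2 ^ N * 1
  ≡⟨ cong (_+ 2 ^ N * 1) (fewerCount-complement t≤N) ⟩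
    2 ^ N + 2 ^ N * 1
  ≡⟨ double (2 ^ N) ⟩
    2 ^ suc N
  ∎
  where
  open ≡-Reasoning
  swap : ∀ a p b → a + p * 1 + b ≡ a + b + p * 1
  swap = solve-∀
  double : ∀ p → p + p * 1 ≡ 2 * p
  double = solve-∀

dyadic-halving : ∀ {N u} → u < N → 2 ^ (N ∸ u) ≡ 2 * 2 ^ (N ∸ suc u)
dyadic-halving (s≤s u≤N) = cong (2 ^_) (+-∸-assoc 1 u≤N)

fewerCount-suc : ∀ {N u} → u < N → fewerCount N (suc u) ≡ fewerCount N u + 2 ^ (N ∸ suc u)
fewerCount-suc {N} {u} u<N = +-cancelʳ-≡ e _ _ (begin
    fewerCount N (suc u) + e
  ≡⟨ fewerCount-complement u<N ⟩
    2 ^ N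
  ≡⟨ sym (fewerCount-complement (<⇒≤ u<N)) ⟩
    fewerCount N u + 2 ^ (N ∸ u)
  ≡⟨ cong (fewerCount N u +_) (dyadic-halving u<N) ⟩
    fewerCount N u + 2 * e
  ≡⟨ split (fewerCount N u) e ⟩
    fewerCount N u + e + e
  ∎)
  where
  open ≡-Reasoning
  e : ℕ
  e = 2 ^ (N ∸ suc u)
  split : ∀ a e → a + 2 * e ≡ a + e + e
  split = solve-∀

fewerCount-grid : ∀ N → HalvingGrid (fewerCount N) (λ u → 2 ^ (N ∸ u)) N
fewerCount-grid N = record
  { start = dyadicSum-zero N
  ; step  = fewerCount-suc
  ; halve = dyadic-halving
  }

winCount-bound : ∀ n N → 2 * (2 ^ N) ^ suc n ≤ 3 * suc n * (winCount (suc n) N + (2 ^ N) ^ n)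
winCount-bound n N = begin
    2 * (2 ^ N) ^ suc n
  ≡⟨ cong (λ y → 2 * y ^ suc n) (sym last) ⟩
    2 * (fewerCount N N + 2 ^ (N ∸ N)) ^ suc n
  ≤⟨ riemann-bound n N (fewerCount-grid N) ⟩
    3 * suc n * 2 ^ (N ∸ N) * (G + (fewerCount N N + 2 ^ (N ∸ N)) ^ n)
  ≡⟨ cong₂ (λ k y → 3 * suc n * 2 ^ k * (G + y ^ n)) (n∸n≡0 N) last ⟩
    3 * suc n * 1 * (G + (2 ^ N) ^ n)
  ≡⟨ cong₂ (λ a g → a * (g + (2 ^ N) ^ n)) (*-identityʳ (3 * suc n)) (sym (winCount-suc n N)) ⟩
    3 * suc n * (winCount (suc n) N + (2 ^ N) ^ n)
  ∎
  where
  open ≤-Reasoning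
  G : ℕ
  G = dyadicSum N (λ t → fewerCount N t ^ n)
  last : fewerCount N N + 2 ^ (N ∸ N) ≡ 2 ^ N
  last = fewerCount-complement (≤-refl {N})

n≤2^n : ∀ n → n ≤ 2 ^ n
n≤2^n zero    = z≤n
n≤2^n (suc n) = +-mono-≤ (m^n>0 2 n) (≤-trans (n≤2^n n) (m≤m+n (2 ^ n) 0))

lemma12 : (d : ℕ) → 1 ≤ d → (m : ℕ) → 1 ≤ m →
    ∃[ N ] (2 * m * 2 ^ (d * N) ≤ 3 * d * m * winCount d N + 3 * d * 2 ^ (d * N))
lemma12 (suc n) _ m _ = m , (begin
    2 * m * 2 ^ (d * m)
  ≡⟨ cong (2 * m *_) 2^dm ⟩
    2 * m * P ^ d
  ≡⟨ reassoc m (P ^ d) ⟩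
    m * (2 * P ^ d)
  ≤⟨ *-monoʳ-≤ m (winCount-bound n m) ⟩
    m * (3 * d * (W + P ^ n))
  ≡⟨ distribute m d W (P ^ n) ⟩
    3 * d * m * W + 3 * d * (m * P ^ n)
  ≤⟨ +-monoʳ-≤ (3 * d * m * W) (*-monoʳ-≤ (3 * d) (*-monoˡ-≤ (P ^ n) (n≤2^n m))) ⟩
    3 * d * m * W + 3 * d * P ^ d
  ≡⟨ cong (λ y → 3 * d * m * W + 3 * d * y) (sym 2^dm) ⟩
    3 * d * m * W + 3 * d * 2 ^ (d * m)
  ∎)
  where
  open ≤-Reasoning
  d P W : ℕ
  d = suc n
  P = 2 ^ m
  W = winCount d m
  2^dm : 2 ^ (d * m) ≡ P ^ d
  2^dm = trans (cong (2 ^_) (*-comm d m)) (sym (^-*-assoc 2 m d))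
  reassoc : ∀ m x → 2 * m * x ≡ m * (2 * x)
  reassoc = solve-∀
  distribute : ∀ m d w x → m * (3 * d * (w + x)) ≡ 3 * d * m * w + 3 * d * (m * x)
  distribute = solve-∀
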